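{- Let $\mathtt{p}$ be a CFTR program that terminates on every input $x\in\{0,1\}^*$. Then there is a polynomial $\pi$ such that $\mathit{time}_{\mathtt{p}}(x) \le \pi(|x|)$ for all $x \in \{0,1\}^*$.
   Context: CF is a first-order, call-by-value functional language with no data constructors. A CF program is a finite sequence of function definitions $\mathtt{f\ x1 \ldots xm = e}$ with distinct parameters; the first definition $\mathtt{f_1\ x = e}$ is the entry function. Expressions are $\mathtt{True}$, $\mathtt{False}$, $\mathtt{[\,]}$, variables, $\mathtt{not\ e}$, $\mathtt{null\ e}$, $\mathtt{head\ e}$, $\mathtt{tail\ e}$, $\mathtt{if\ e\ then\ e\ else\ e}$, and calls $\mathtt{f\ e1\ldots em}$ to defined functions. Values are bits or bit lists. The semantics is given by big-step inference rules $\mathtt{p},\rho\vdash \mathtt{e}\to v$ with the usual meaning of the base functions and conditionals. A call evaluates its arguments and then the body of the called function in the new environment binding its parameters. The derivation tree for input $x$ is the computation tree $\mathcal{T}^{\mathtt{p},x}$, and $\mathit{time}_{\mathtt{p}}(x)=|\mathcal{T}^{\mathtt{p},x}|$ is its number of nodes. CFTR (tail-recursive CF) is defined through the classification $\alpha:\mathrm{Exp}\to\{X,T,N\}$, ordered $X<T<N$: - $\alpha(\text{constant})=X$. - $\alpha(\text{variable})=X$. - $\alpha(\mathtt{base\ e})=X$ if $\alpha(\mathtt{e})=X$, and $N$ otherwise. - $\alpha(\mathtt{f\ e1\ldots em})=T$ if all $\alpha(\mathtt{ei})=X$, and $N$ otherwise. - $\alpha(\mathtt{if\ e0\ then\ e1\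 else\ e2})=\max(\alpha(\mathtt{e1}),\alpha(\mathtt{e2}))$ if $\alpha(\mathtt{e0})=X$, and $N$ otherwise. A CF program is in CFTR iff every definition body $\mathtt{e}$ has $\alpha(\mathtt{e})\in\{X,T\}$. -}

module Defs where

open import Data.Nat using (ℕ; zero; suc; _+_; _*_; _≤_)
open import Data.Fin using (Fin; zero; suc)
open import Data.Bool using (Bool; true; false; _∧_) renaming (not to bnot)
open import Data.List using (List; []; _∷_; length)
open import Data.Vec using (Vec; []; _∷_; lookup)
open import Data.Product using (Σ; _,_)
open import Relation.Binary.PropositionalEquality using (_≡_; _≢_; subst; sym)

-- Syntax of CF.  Function names of a program are Fin k, with arities
-- ar : Fin k → ℕ.  Parameters of a definition with arity m are Fin m
-- (de Bruijn style, hence automatically distinct).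

data Exp {k : ℕ} (ar : Fin k → ℕ) (m : ℕ) : Set where
  cTrue cFalse cNil : Exp ar m
  var   : Fin m → Exp ar m
  cnot cnull chead ctail : Exp ar m → Exp ar m
  cif   : Exp ar m → Exp ar m → Exp ar m → Exp ar m
  call  : (f : Fin k) → Vec (Exp ar m) (ar f) → Exp ar m

-- A program: definitions f₁ … f_{k+1}; f₁ (index zero) is the entry
-- function, which has exactly one parameter.
record Program : Set where
  field
    k     : ℕ
    ar    : Fin (suc k) → ℕ
    body  : (f : Fin (suc k)) → Exp ar (ar f)
    entry-unary : ar zero ≡ 1
open Program public

data Val : Set where
  bit : Bool → Val
  lst : List Bool → Val

-- Big-step semantics  p, ρ ⊢ e → v  (derivations are data, so they are
-- computation trees).  head/tail of [] and ill-typed uses have no rule.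

module _ (p : Program) where
  private
    A = ar p

  mutual
    data Eval : {m : ℕ} → Vec Val m → Exp A m → Val → Set where
      eTrue  : ∀ {m} {ρ : Vec Val m} → Eval ρ cTrue (bit true)
      eFalse : ∀ {m} {ρ : Vec Val m} → Eval ρ cFalse (bit false)
      eNil   : ∀ {m} {ρ : Vec Val m} → Eval ρ cNil (lst [])
      eVar   : ∀ {m} {ρ : Vec Val m} (i : Fin m) → Eval ρ (var i) (lookup ρ i)
      eNot   : ∀ {m} {ρ : Vec Val m} {e b} → Eval ρ e (bit b) → Eval ρ (cnot e) (bit (bnot b))
      eNull[] : ∀ {m} {ρ : Vec Val m} {e} → Eval ρ e (lst []) → Eval ρ (cnull e) (bit true)
      eNull∷ : ∀ {m} {ρ : Vec Val m} {e b l} → Eval ρ e (lst (b ∷ l)) → Eval ρ (cnull e) (bit false)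
      eHead  : ∀ {m} {ρ : Vec Val m} {e b l} → Eval ρ e (lst (b ∷ l)) → Eval ρ (chead e) (bit b)
      eTail  : ∀ {m} {ρ : Vec Val m} {e b l} → Eval ρ e (lst (b ∷ l)) → Eval ρ (ctail e) (lst l)
      eIfT   : ∀ {m} {ρ : Vec Val m} {e0 e1 e2 v} →
               Eval ρ e0 (bit true) → Eval ρ e1 v → Eval ρ (cif e0 e1 e2) v
      eIfF   : ∀ {m} {ρ : Vec Val m} {e0 e1 e2 v} →
               Eval ρ e0 (bit false) → Eval ρ e2 v → Eval ρ (cif e0 e1 e2) v
      eCall  : ∀ {m} {ρ : Vec Val m} {f es vs v} →
               EvalArgs ρ es vs → Eval vs (body p f) v → Eval ρ (call f es) v

    data EvalArgs : {m n : ℕ} → Vec Val m → Vec (Exp A m) n → Vec Val n → Set where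
      []  : ∀ {m} {ρ : Vec Val m} → EvalArgs ρ [] []
      _∷_ : ∀ {m n} {ρ : Vec Val m} {e v} {es : Vec (Exp A m) n} {vs} →
            Eval ρ e v → EvalArgs ρ es vs → EvalArgs ρ (e ∷ es) (v ∷ vs)

  mutual
    size : ∀ {m} {ρ : Vec Val m} {e v} → Eval ρ e v → ℕ
    size eTrue = 1
    size eFalse = 1
    size eNil = 1
    size (eVar i) = 1
    size (eNot d) = suc (size d)
    size (eNull[] d) = suc (size d)
    size (eNull∷ d) = suc (size d)
    size (eHead d) = suc (size d)
    size (eTail d) = suc (size d)
    size (eIfT d d₁) = suc (size d + size d₁)
    size (eIfF d d₁) = suc (size d + size d₁)
    size (eCall ds d) = suc (sizeArgs ds + size d)

    sizeArgs : ∀ {m n} {ρ : Vec Val m} {es : Vec (Exp A m) n} {vs} → EvalArgs ρ es vs → ℕ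
    sizeArgs [] = 0
    sizeArgs (d ∷ ds) = size d + sizeArgs ds

  inputEnv : List Bool → Vec Val (ar p zero)
  inputEnv x = subst (Vec Val) (sym (entry-unary p)) (lst x ∷ [])

  Run : List Bool → Val → Set
  Run x v = Eval (inputEnv x) (body p zero) v

  time : ∀ {x v} → Run x v → ℕ
  time d = size d

data Cls : Set where
  X T N : Cls

max : Cls → Cls → Cls
max X c = c
max T X = T
max T T = T
max T N = N
max N _ = N

isX : Cls → Bool
isX X = true
isX _ = false

mutual
  α : ∀ {k} {ar : Fin k → ℕ} {m} → Exp ar m → Cls
  α cTrue = X
  α cFalse = X
  α cNil = X
  α (var _) = X
  α (cnot e) = baseCls (α e)
  α (cnull e) = baseCls (α e)
  α (chead e) = baseCls (α e)
  α (ctail e) = baseCls (α e)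
  α (cif e0 e1 e2) with α e0
  ... | X = max (α e1) (α e2)
  ... | _ = N
  α (call f es) with allX es
  ... | true = T
  ... | false = N

  allX : ∀ {k} {ar : Fin k → ℕ} {m n} → Vec (Exp ar m) n → Bool
  allX [] = true
  allX (e ∷ es) = isX (α e) ∧ allX es

  baseCls : Cls → Cls
  baseCls X = X
  baseCls _ = N

CFTR : Program → Set
CFTR p = (f : Fin (suc (k p))) → α (body p f) ≢ N

-- Polynomials with natural coefficients (c₀ ∷ c₁ ∷ … = c₀ + c₁ n + …).

Poly : Set
Poly = List ℕ

evalPoly : Poly → ℕ → ℕ
evalPoly [] n = 0
evalPoly (c ∷ cs) n = c + n * evalPoly cs n

module Submission where

-- In a CFTR body every call is in tail position and has argument
-- expressions of class X, i.e. without calls.  Hence a computation tree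
-- consists of one "tail spine" of calls f₁ ρ₁, f₂ ρ₂, … (the
-- configurations entered), each node of which carries at most C further
-- nodes, C a bound on the body sizes.  So  time ≤ C · (1 + |spine|).
--   * The configurations on the spine are pairwise distinct: a repeated
--     configuration would have a strictly smaller derivation of the same
--     judgment, contradicting that evaluation is deterministic, sizes
--     included.
--   * Every value ever computed on input x is a bit or a suffix of x, so
--     every configuration lies in an explicit list of length at most
--     K · (3 + |x|)^M  (K functions, M a bound on the arities).
-- A duplicate-free list inside a list is no longer than it (pigeonhole),
-- which yields  time ≤ C · K · (3 + |x|)^M, a polynomial in |x|.

open import Defs
open import Data.Nat using (ℕ; zero; suc; _+_; _*_; _^_; _≤_; _<_; z≤n; s≤s)
open import Data.Nat.Properties
open import Data.Nat.Solver using (module +-*-Solver)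
open import Data.Bool using (Bool; true; false; _∧_)
open import Data.List using (List; []; _∷_; length; map; concatMap; cartesianProductWith; allFin; _++_)
import Data.List as List
open import Data.List.Properties using (length-map; length-++; length-tabulate)
open import Data.List.Membership.Propositional using (_∈_)
open import Data.List.Membership.Propositional.Properties
  using (∈-lookup; ∈-map⁺; ∈-concatMap⁺; ∈-cartesianProductWith⁺; ∈-allFin)
open import Data.List.Relation.Unary.Any using (here; there; index)
import Data.List.Relation.Unary.Any as Any
open import Data.List.Relation.Unary.Any.Properties using (lookup-index)
import Data.List.Relation.Unary.All as All
open import Data.List.Relation.Unary.AllPairs using ([]; _∷_)
open import Data.List.Relation.Unary.Unique.Propositional using (Unique)
open import Data.Fin using (Fin; zero; suc)
open import Data.Fin.Properties using (pigeonhole) renaming (<⇒≢ to <⇒≢ᶠ)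
open import Data.Vec using (Vec; []; _∷_; lookup)
open import Data.Product using (Σ; ∃-syntax; _,_; proj₁; proj₂; _×_)
open import Data.Empty using (⊥-elim)
open import Function using (_∘_)
open import Relation.Binary.PropositionalEquality

open +-*-Solver

baseCls-X : ∀ {c} → baseCls c ≡ X → c ≡ X
baseCls-X {X} _ = refl

baseCls-notN : ∀ c → baseCls c ≢ N → baseCls c ≡ X
baseCls-notN X _ = refl
baseCls-notN T h = ⊥-elim (h refl)
baseCls-notN N h = ⊥-elim (h refl)

max-X : ∀ {a b} → max a b ≡ X → a ≡ X × b ≡ X
max-X {X} {X} _ = refl , refl
max-X {X} {T} ()
max-X {X} {N} ()
max-X {T} {X} ()
max-X {T} {T} ()
max-X {T} {N} ()

max-notNˡ : ∀ {a b} → max a b ≢ N → a ≢ N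
max-notNˡ {N} h _ = h refl

max-notNʳ : ∀ {a b} → max a b ≢ N → b ≢ N
max-notNʳ {X} h = h
max-notNʳ {T} {N} h _ = h refl
max-notNʳ {N} h _ = h refl

isX-∧ : ∀ a b → isX a ∧ b ≡ true → a ≡ X × b ≡ true
isX-∧ X b h = refl , h

mutual
  esize : ∀ {k} {ar : Fin k → ℕ} {m} → Exp ar m → ℕ
  esize cTrue = 1
  esize cFalse = 1
  esize cNil = 1
  esize (var _) = 1
  esize (cnot e) = suc (esize e)
  esize (cnull e) = suc (esize e)
  esize (chead e) = suc (esize e)
  esize (ctail e) = suc (esize e)
  esize (cif e0 e1 e2) = suc (esize e0 + (esize e1 + esize e2))
  esize (call f es) = suc (esizes es)

  esizes : ∀ {k} {ar : Fin k → ℕ} {m n} → Vec (Exp ar m) n → ℕ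
  esizes [] = 0
  esizes (e ∷ es) = esize e + esizes es

finBounded : ∀ {n} (g : Fin n → ℕ) → ∃[ M ] (∀ i → g i ≤ M)
finBounded {zero} g = 0 , λ ()
finBounded {suc n} g with finBounded (g ∘ suc)
... | M , bounded = g zero + M , λ { zero → m≤m+n _ _
                                    ; (suc i) → ≤-trans (bounded i) (m≤n+m _ _) }

-- A duplicate-free list all of whose elements occur in ys is
-- no longer than ys: otherwise the map sending a position of xs to a
-- position of its element in ys would identify two positions (pigeonhole),
-- i.e. xs would contain a repetition.

unique-lookup-injective : ∀ {A : Set} {xs : List A} → Unique xs →
  ∀ {i j} → List.lookup xs i ≡ List.lookup xs j → i ≡ j
unique-lookup-injective (_ ∷ _) {zero} {zero} _ = refl
unique-lookup-injective (x≢ ∷ _) {zero} {suc j} eq = ⊥-elim (All.lookup x≢ (∈-lookup j) eq)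
unique-lookup-injective (x≢ ∷ _) {suc i} {zero} eq = ⊥-elim (All.lookup x≢ (∈-lookup i) (sym eq))
unique-lookup-injective (_ ∷ u) {suc i} {suc j} eq = cong suc (unique-lookup-injective u eq)

unique-length-≤ : ∀ {A : Set} {xs ys : List A} → Unique xs →
  (∀ {z} → z ∈ xs → z ∈ ys) → length xs ≤ length ys
unique-length-≤ {xs = xs} {ys} u sub = ≮⇒≥ λ ys<xs →
  let (i , j , i<j , same) = pigeonhole ys<xs position
  in <⇒≢ᶠ i<j (unique-lookup-injective u (begin
       List.lookup xs i             ≡⟨ element i ⟩
       List.lookup ys (position i)  ≡⟨ cong (List.lookup ys) same ⟩
       List.lookup ys (position j)  ≡⟨ sym (element j) ⟩
       List.lookup xs j             ∎))
  where
    open ≡-Reasoning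
    position : Fin (length xs) → Fin (length ys)
    position i = index (sub (∈-lookup i))
    element : ∀ i → List.lookup xs i ≡ List.lookup ys (position i)
    element i = lookup-index (sub (∈-lookup i))

vecsOver : ∀ {A : Set} → List A → (m : ℕ) → List (Vec A m)
vecsOver l zero = [] ∷ []
vecsOver l (suc m) = cartesianProductWith _∷_ l (vecsOver l m)

length-cartesianProductWith : ∀ {A B C : Set} (f : A → B → C) (xs : List A) (ys : List B) →
  length (cartesianProductWith f xs ys) ≡ length xs * length ys
length-cartesianProductWith f [] ys = refl
length-cartesianProductWith f (x ∷ xs) ys = begin
  length (map (f x) ys ++ cartesianProductWith f xs ys)  ≡⟨ length-++ (map (f x) ys) ⟩
  length (map (f x) ys) + length (cartesianProductWith f xs ys)
    ≡⟨ cong₂ _+_ (length-map (f x) ys) (length-cartesianProductWith f xs ys) ⟩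
  length ys + length xs * length ys  ∎
  where open ≡-Reasoning

length-vecsOver : ∀ {A : Set} (l : List A) m → length (vecsOver l m) ≡ length l ^ m
length-vecsOver l zero = refl
length-vecsOver l (suc m) = trans (length-cartesianProductWith _∷_ l (vecsOver l m))
                                  (cong (length l *_) (length-vecsOver l m))

∈-vecsOver : ∀ {A : Set} {l : List A} {m} (v : Vec A m) → (∀ i → lookup v i ∈ l) → v ∈ vecsOver l m
∈-vecsOver [] _ = here refl
∈-vecsOver (a ∷ v) inl = ∈-cartesianProductWith⁺ _∷_ (inl zero) (∈-vecsOver v (inl ∘ suc))

length-concatMap-≤ : ∀ {A B : Set} (g : A → List B) {c} → (∀ a → length (g a) ≤ c) →
  ∀ xs → length (concatMap g xs) ≤ length xs * c
length-concatMap-≤ g short [] = z≤n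
length-concatMap-≤ g short (a ∷ xs) = begin
  length (g a ++ concatMap g xs)      ≡⟨ length-++ (g a) ⟩
  length (g a) + length (concatMap g xs) ≤⟨ +-mono-≤ (short a) (length-concatMap-≤ g short xs) ⟩
  _ + length xs * _                    ∎
  where open ≤-Reasoning

suffixes : ∀ {A : Set} → List A → List (List A)
suffixes [] = [] ∷ []
suffixes (b ∷ y) = (b ∷ y) ∷ suffixes y

length-suffixes : ∀ {A : Set} (y : List A) → length (suffixes y) ≡ suc (length y)
length-suffixes [] = refl
length-suffixes (b ∷ y) = cong suc (length-suffixes y)

[]-suffix : ∀ {A : Set} (y : List A) → [] ∈ suffixes y
[]-suffix [] = here refl
[]-suffix (b ∷ y) = there ([]-suffix y)

self-suffix : ∀ {A : Set} (y : List A) → y ∈ suffixes y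
self-suffix [] = here refl
self-suffix (b ∷ y) = here refl

tail-suffix : ∀ {A : Set} {b : A} {l} y → (b ∷ l) ∈ suffixes y → l ∈ suffixes y
tail-suffix [] (here ())
tail-suffix [] (there ())
tail-suffix (c ∷ y) (here refl) = there (self-suffix y)
tail-suffix (c ∷ y) (there s) = there (tail-suffix y s)

addP : Poly → Poly → Poly
addP [] q = q
addP (a ∷ p) [] = a ∷ p
addP (a ∷ p) (b ∷ q) = a + b ∷ addP p q

evalPoly-addP : ∀ p q n → evalPoly (addP p q) n ≡ evalPoly p n + evalPoly q n
evalPoly-addP [] q n = refl
evalPoly-addP (a ∷ p) [] n = sym (+-identityʳ _)
evalPoly-addP (a ∷ p) (b ∷ q) n rewrite evalPoly-addP p q n =
  solve 5 (λ a b n P Q → (a :+ b) :+ n :* (P :+ Q) := (a :+ n :* P) :+ (b :+ n :* Q)) refl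
    a b n (evalPoly p n) (evalPoly q n)

scaleP : ℕ → Poly → Poly
scaleP c [] = []
scaleP c (a ∷ p) = c * a ∷ scaleP c p

evalPoly-scaleP : ∀ c p n → evalPoly (scaleP c p) n ≡ c * evalPoly p n
evalPoly-scaleP c [] n = sym (*-zeroʳ c)
evalPoly-scaleP c (a ∷ p) n rewrite evalPoly-scaleP c p n =
  solve 4 (λ c a n P → c :* a :+ n :* (c :* P) := c :* (a :+ n :* P)) refl c a n (evalPoly p n)

linPow : ℕ → ℕ → Poly
linPow a zero = 1 ∷ []
linPow a (suc M) = addP (scaleP a (linPow a M)) (0 ∷ linPow a M)

evalPoly-linPow : ∀ a M n → evalPoly (linPow a M) n ≡ (a + n) ^ M
evalPoly-linPow a zero n = cong suc (*-zeroʳ n)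
evalPoly-linPow a (suc M) n = begin
  evalPoly (addP (scaleP a P) (0 ∷ P)) n       ≡⟨ evalPoly-addP (scaleP a P) (0 ∷ P) n ⟩
  evalPoly (scaleP a P) n + n * evalPoly P n  ≡⟨ cong (_+ n * evalPoly P n) (evalPoly-scaleP a P n) ⟩
  a * evalPoly P n + n * evalPoly P n         ≡⟨ sym (*-distribʳ-+ (evalPoly P n) a n) ⟩
  (a + n) * evalPoly P n                      ≡⟨ cong ((a + n) *_) (evalPoly-linPow a M n) ⟩
  (a + n) ^ suc M                             ∎
  where
    open ≡-Reasoning
    P = linPow a M

-- Arithmetic shapes of the size bounds for conditionals and calls.

branch-bound : ∀ {a a' b b' s} c → a ≤ a' → b ≤ b' + c → b' ≤ s → suc (a + b) ≤ suc (a' + s) + c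
branch-bound {a} {a'} {b} {b'} {s} c a≤ b≤ b'≤ = begin
  suc (a + b)         ≤⟨ s≤s (+-mono-≤ a≤ (≤-trans b≤ (+-monoˡ-≤ c b'≤))) ⟩
  suc (a' + (s + c))  ≡⟨ cong suc (sym (+-assoc a' s c)) ⟩
  suc (a' + s) + c    ∎
  where open ≤-Reasoning

call-bound : ∀ {a a' b b' C} L → a ≤ a' → b ≤ b' + C * L → b' ≤ C → suc (a + b) ≤ suc a' + C * suc L
call-bound {a} {a'} {b} {b'} {C} L a≤ b≤ b'≤ = begin
  suc (a + b)            ≤⟨ s≤s (+-mono-≤ a≤ (≤-trans b≤ (+-monoˡ-≤ (C * L) b'≤))) ⟩
  suc (a' + (C + C * L)) ≡⟨ cong (λ z → suc (a' + z)) (sym (*-suc C L)) ⟩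
  suc a' + C * suc L     ∎
  where open ≤-Reasoning

module Analysis (p : Program) where

  K : ℕ
  K = suc (k p)

  Config : Set
  Config = Σ (Fin K) (λ f → Vec Val (ar p f))

  configAt : (f : Fin K) → Vec Val (ar p f) → Config
  configAt f ρ = f , ρ

  -- The tail spine: the configurations entered along the path of tail
  -- positions (if-branches and call bodies) of a computation tree.
  spine : ∀ {m} {ρ : Vec Val m} {e v} → Eval p ρ e v → List Config
  spine (eIfT _ d) = spine d
  spine (eIfF _ d) = spine d
  spine (eCall {f = f} {vs = vs} _ d) = (f , vs) ∷ spine d
  spine _ = []

  size-X : ∀ {m} {ρ : Vec Val m} {e v} → α e ≡ X → (d : Eval p ρ e v) → size p d ≤ esize e
  size-X h eTrue = ≤-refl
  size-X h eFalse = ≤-refl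
  size-X h eNil = ≤-refl
  size-X h (eVar i) = ≤-refl
  size-X h (eNot d) = s≤s (size-X (baseCls-X h) d)
  size-X h (eNull[] d) = s≤s (size-X (baseCls-X h) d)
  size-X h (eNull∷ d) = s≤s (size-X (baseCls-X h) d)
  size-X h (eHead d) = s≤s (size-X (baseCls-X h) d)
  size-X h (eTail d) = s≤s (size-X (baseCls-X h) d)
  size-X {e = cif e0 e1 e2} h (eIfT d0 d1) with α e0 in eq
  ... | X = s≤s (+-mono-≤ (size-X eq d0) (≤-trans (size-X (proj₁ (max-X h)) d1) (m≤m+n _ _)))
  size-X {e = cif e0 e1 e2} h (eIfF d0 d2) with α e0 in eq
  ... | X = s≤s (+-mono-≤ (size-X eq d0) (≤-trans (size-X (proj₂ (max-X h)) d2) (m≤n+m _ _)))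
  size-X {e = call f es} h (eCall ds d) with allX es
  size-X {e = call f es} () (eCall ds d) | true
  size-X {e = call f es} () (eCall ds d) | false

  size-args-X : ∀ {m n} {ρ : Vec Val m} {es : Vec (Exp (ar p) m) n} {vs} → allX es ≡ true →
                (ds : EvalArgs p ρ es vs) → sizeArgs p ds ≤ esizes es
  size-args-X h [] = z≤n
  size-args-X {es = e ∷ es} h (d ∷ ds) =
    let (e-X , es-X) = isX-∧ (α e) (allX es) h in +-mono-≤ (size-X e-X d) (size-args-X es-X ds)

  module _ (cftr : CFTR p) (C : ℕ) (body≤C : ∀ f → esize (body p f) ≤ C) where
    size-tail : ∀ {m} {ρ : Vec Val m} {e v} → α e ≢ N → (d : Eval p ρ e v) →
                size p d ≤ esize e + C * length (spine d)
    size-tail {e = cif e0 e1 e2} h (eIfT d0 d1) with α e0 in eq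
    ... | X = branch-bound (C * length (spine d1)) (size-X eq d0) (size-tail (max-notNˡ h) d1) (m≤m+n _ _)
    ... | T = ⊥-elim (h refl)
    ... | N = ⊥-elim (h refl)
    size-tail {e = cif e0 e1 e2} h (eIfF d0 d2) with α e0 in eq
    ... | X = branch-bound (C * length (spine d2)) (size-X eq d0) (size-tail (max-notNʳ h) d2) (m≤n+m _ _)
    ... | T = ⊥-elim (h refl)
    ... | N = ⊥-elim (h refl)
    size-tail {e = call f es} h (eCall ds d) with allX es in eq
    ... | true = call-bound (length (spine d)) (size-args-X eq ds) (size-tail (cftr f) d) (body≤C f)
    ... | false = ⊥-elim (h refl)
    size-tail {e = cTrue} h d = ≤-trans (size-X refl d) (m≤m+n _ _)
    size-tail {e = cFalse} h d = ≤-trans (size-X refl d) (m≤m+n _ _)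
    size-tail {e = cNil} h d = ≤-trans (size-X refl d) (m≤m+n _ _)
    size-tail {e = var _} h d = ≤-trans (size-X refl d) (m≤m+n _ _)
    size-tail {e = cnot e} h d = ≤-trans (size-X (baseCls-notN (α e) h) d) (m≤m+n _ _)
    size-tail {e = cnull e} h d = ≤-trans (size-X (baseCls-notN (α e) h) d) (m≤m+n _ _)
    size-tail {e = chead e} h d = ≤-trans (size-X (baseCls-notN (α e) h) d) (m≤m+n _ _)
    size-tail {e = ctail e} h d = ≤-trans (size-X (baseCls-notN (α e) h) d) (m≤m+n _ _)

  mutual
    deterministic : ∀ {m} {ρ : Vec Val m} {e v v'} (d : Eval p ρ e v) (d' : Eval p ρ e v') →
                    v ≡ v' × size p d ≡ size p d'
    deterministic eTrue eTrue = refl , refl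
    deterministic eFalse eFalse = refl , refl
    deterministic eNil eNil = refl , refl
    deterministic (eVar i) (eVar .i) = refl , refl
    deterministic (eNot d) (eNot d') with deterministic d d'
    ... | refl , s = refl , cong suc s
    deterministic (eNull[] d) (eNull[] d') = refl , cong suc (proj₂ (deterministic d d'))
    deterministic (eNull[] d) (eNull∷ d') with deterministic d d'
    ... | () , _
    deterministic (eNull∷ d) (eNull[] d') with deterministic d d'
    ... | () , _
    deterministic (eNull∷ d) (eNull∷ d') = refl , cong suc (proj₂ (deterministic d d'))
    deterministic (eHead d) (eHead d') with deterministic d d'
    ... | refl , s = refl , cong suc s
    deterministic (eTail d) (eTail d') with deterministic d d'
    ... | refl , s = refl , cong suc s
    deterministic (eIfT d0 d1) (eIfT d0' d1') with deterministic d1 d1'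
    ... | refl , s = refl , cong suc (cong₂ _+_ (proj₂ (deterministic d0 d0')) s)
    deterministic (eIfT d0 d1) (eIfF d0' d1') with deterministic d0 d0'
    ... | () , _
    deterministic (eIfF d0 d1) (eIfT d0' d1') with deterministic d0 d0'
    ... | () , _
    deterministic (eIfF d0 d1) (eIfF d0' d1') with deterministic d1 d1'
    ... | refl , s = refl , cong suc (cong₂ _+_ (proj₂ (deterministic d0 d0')) s)
    deterministic (eCall ds d) (eCall ds' d') with deterministic-args ds ds'
    ... | refl , sa with deterministic d d'
    ...   | refl , s = refl , cong suc (cong₂ _+_ sa s)

    deterministic-args : ∀ {m n} {ρ : Vec Val m} {es : Vec (Exp (ar p) m) n} {vs vs'}
                         (ds : EvalArgs p ρ es vs) (ds' : EvalArgs p ρ es vs') →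
                         vs ≡ vs' × sizeArgs p ds ≡ sizeArgs p ds'
    deterministic-args [] [] = refl , refl
    deterministic-args (d ∷ ds) (d' ∷ ds') with deterministic d d' | deterministic-args ds ds'
    ... | refl , s | refl , sa = refl , cong₂ _+_ s sa

  spine-smaller : ∀ {m} {ρ : Vec Val m} {e v} (d : Eval p ρ e v) {c} → c ∈ spine d →
    ∃[ v' ] Σ (Eval p (proj₂ c) (body p (proj₁ c)) v') (λ d' → size p d' < size p d)
  spine-smaller (eIfT d0 d1) c∈ =
    let (v' , d' , lt) = spine-smaller d1 c∈ in v' , d' , ≤-trans lt (m≤n⇒m≤1+n (m≤n+m _ _))
  spine-smaller (eIfF d0 d1) c∈ =
    let (v' , d' , lt) = spine-smaller d1 c∈ in v' , d' , ≤-trans lt (m≤n⇒m≤1+n (m≤n+m _ _))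
  spine-smaller (eCall {v = v} ds d) (here refl) = v , d , s≤s (m≤n+m _ _)
  spine-smaller (eCall ds d) (there c∈) =
    let (v' , d' , lt) = spine-smaller d c∈ in v' , d' , ≤-trans lt (m≤n⇒m≤1+n (m≤n+m _ _))

  mutual
    body-spine-unique : ∀ {f} {ρ : Vec Val (ar p f)} {v} (d : Eval p ρ (body p f) v) →
                        Unique ((f , ρ) ∷ spine d)
    body-spine-unique d = All.tabulate fresh ∷ spine-unique d
      where
        fresh : ∀ {c} → c ∈ spine d → _ ≢ c
        fresh c∈ refl = let (_ , d' , lt) = spine-smaller d c∈
                        in <-irrefl (proj₂ (deterministic d' d)) lt

    spine-unique : ∀ {m} {ρ : Vec Val m} {e v} (d : Eval p ρ e v) → Unique (spine d)
    spine-unique (eIfT _ d) = spine-unique d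
    spine-unique (eIfF _ d) = spine-unique d
    spine-unique (eCall _ d) = body-spine-unique d
    spine-unique eTrue = []
    spine-unique eFalse = []
    spine-unique eNil = []
    spine-unique (eVar i) = []
    spine-unique (eNot d) = []
    spine-unique (eNull[] d) = []
    spine-unique (eNull∷ d) = []
    spine-unique (eHead d) = []
    spine-unique (eTail d) = []

  module OnInput (x : List Bool) where

    data Good : Val → Set where
      good-bit : ∀ b → Good (bit b)
      good-lst : ∀ {l} → l ∈ suffixes x → Good (lst l)

    GoodEnv : ∀ {m} → Vec Val m → Set
    GoodEnv ρ = ∀ i → Good (lookup ρ i)

    mutual
      eval-good : ∀ {m} {ρ : Vec Val m} {e v} → GoodEnv ρ → Eval p ρ e v → Good v
      eval-good g eTrue = good-bit _
      eval-good g eFalse = good-bit _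
      eval-good g eNil = good-lst ([]-suffix x)
      eval-good g (eVar i) = g i
      eval-good g (eNot d) = good-bit _
      eval-good g (eNull[] d) = good-bit _
      eval-good g (eNull∷ d) = good-bit _
      eval-good g (eHead d) = good-bit _
      eval-good g (eTail d) with eval-good g d
      ... | good-lst s = good-lst (tail-suffix x s)
      eval-good g (eIfT _ d) = eval-good g d
      eval-good g (eIfF _ d) = eval-good g d
      eval-good g (eCall ds d) = eval-good (args-good g ds) d

      args-good : ∀ {m n} {ρ : Vec Val m} {es : Vec (Exp (ar p) m) n} {vs} → GoodEnv ρ →
                  EvalArgs p ρ es vs → GoodEnv vs
      args-good g (d ∷ ds) zero = eval-good g d
      args-good g (d ∷ ds) (suc i) = args-good g ds i

    spine-good : ∀ {m} {ρ : Vec Val m} {e v} → GoodEnv ρ → (d : Eval p ρ e v) →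
                 ∀ {c} → c ∈ spine d → GoodEnv (proj₂ c)
    spine-good g (eIfT _ d) c∈ = spine-good g d c∈
    spine-good g (eIfF _ d) c∈ = spine-good g d c∈
    spine-good g (eCall ds d) (here refl) = args-good g ds
    spine-good g (eCall ds d) (there c∈) = spine-good (args-good g ds) d c∈

    input-good : GoodEnv (inputEnv p x)
    input-good = go (sym (entry-unary p))
      where
        go : ∀ {m} (eq : 1 ≡ m) → GoodEnv (subst (Vec Val) eq (lst x ∷ []))
        go refl zero = good-lst (self-suffix x)

    goodVals : List Val
    goodVals = bit true ∷ bit false ∷ map lst (suffixes x)

    B : ℕ
    B = length goodVals

    length-goodVals : B ≡ 3 + length x
    length-goodVals = cong (2 +_) (trans (length-map lst (suffixes x)) (length-suffixes x))

    good-∈ : ∀ {v} → Good v → v ∈ goodVals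
    good-∈ (good-bit true) = here refl
    good-∈ (good-bit false) = there (here refl)
    good-∈ (good-lst s) = there (there (∈-map⁺ lst s))

    goodConfigsOf : (f : Fin K) → List Config
    goodConfigsOf f = map (configAt f) (vecsOver goodVals (ar p f))

    goodConfigs : List Config
    goodConfigs = concatMap goodConfigsOf (allFin K)

    good-∈-goodConfigs : ∀ {f ρ} → GoodEnv ρ → (f , ρ) ∈ goodConfigs
    good-∈-goodConfigs {f} {ρ} g =
      ∈-concatMap⁺ goodConfigsOf
        (Any.map (λ { refl → ∈-map⁺ (configAt f) (∈-vecsOver ρ (good-∈ ∘ g)) }) (∈-allFin f))

    length-goodConfigs : ∀ M → (∀ f → ar p f ≤ M) → length goodConfigs ≤ K * B ^ M
    length-goodConfigs M ar≤M = begin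
      length goodConfigs  ≤⟨ length-concatMap-≤ goodConfigsOf short (allFin K) ⟩
      length (allFin K) * B ^ M ≡⟨ cong (_* B ^ M) (length-tabulate {n = K} (λ f → f)) ⟩
      K * B ^ M           ∎
      where
        open ≤-Reasoning
        short : ∀ f → length (goodConfigsOf f) ≤ B ^ M
        short f = begin
          length (goodConfigsOf f)                         ≡⟨ length-map (configAt f) (vecsOver goodVals (ar p f)) ⟩
          length (vecsOver goodVals (ar p f))              ≡⟨ length-vecsOver goodVals (ar p f) ⟩
          B ^ ar p f                                       ≤⟨ ^-monoʳ-≤ B (ar≤M f) ⟩
          B ^ M                                            ∎

    run-spine-bound : ∀ M → (∀ f → ar p f ≤ M) → ∀ {v} (d : Run p x v) →
                      suc (length (spine d)) ≤ K * (3 + length x) ^ M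
    run-spine-bound M ar≤M d = subst (λ b → suc (length (spine d)) ≤ K * b ^ M) length-goodVals
      (≤-trans (unique-length-≤ (body-spine-unique d) in-goodConfigs) (length-goodConfigs M ar≤M))
      where
        in-goodConfigs : ∀ {c} → c ∈ (zero , inputEnv p x) ∷ spine d → c ∈ goodConfigs
        in-goodConfigs (here refl) = good-∈-goodConfigs input-good
        in-goodConfigs (there c∈) = good-∈-goodConfigs (spine-good input-good d c∈)

-- time ≤ C · K · (3 + |x|)^M  for every run.
theorem3 : (p : Program) → CFTR p →
    ((x : List Bool) → Σ Val (λ v → Run p x v)) →
    Σ Poly (λ π → (x : List Bool) (v : Val) (d : Run p x v) →
      time p d ≤ evalPoly π (length x))
theorem3 p cftr _ = scaleP (C * K) (linPow 3 M) , bound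
  where
    open Analysis p
    C M : ℕ
    C = proj₁ (finBounded (λ f → esize (body p f)))
    M = proj₁ (finBounded (ar p))

    body≤C : ∀ f → esize (body p f) ≤ C
    body≤C = proj₂ (finBounded (λ f → esize (body p f)))

    ar≤M : ∀ f → ar p f ≤ M
    ar≤M = proj₂ (finBounded (ar p))

    bound : (x : List Bool) (v : Val) (d : Run p x v) →
            time p d ≤ evalPoly (scaleP (C * K) (linPow 3 M)) (length x)
    bound x v d = begin
      size p d                          ≤⟨ size-tail cftr C body≤C (cftr zero) d ⟩
      esize (body p zero) + C * L       ≤⟨ +-monoˡ-≤ (C * L) (body≤C zero) ⟩
      C + C * L                         ≡⟨ sym (*-suc C L) ⟩
      C * suc L                         ≤⟨ *-monoʳ-≤ C (run-spine-bound M ar≤M d) ⟩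
      C * (K * (3 + n) ^ M)             ≡⟨ sym (*-assoc C K ((3 + n) ^ M)) ⟩
      C * K * (3 + n) ^ M               ≡⟨ cong (C * K *_) (sym (evalPoly-linPow 3 M n)) ⟩
      C * K * evalPoly (linPow 3 M) n   ≡⟨ sym (evalPoly-scaleP (C * K) (linPow 3 M) n) ⟩
      evalPoly (scaleP (C * K) (linPow 3 M)) n ∎
      where
        open ≤-Reasoning
        open OnInput x
        n = length x
        L = length (spine d)
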